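{- Every $5$-uniform intersecting hypergraph with exactly $11$ edges has covering number at most $4$.
   Context: A hypergraph is $r$-uniform if every edge has exactly $r$ vertices, and intersecting if any two edges share at least one vertex. The covering number is the minimum size of a set of vertices meeting every edge. Hypergraphs are finite and simple. -}

module Defs where

open import Data.Nat using (ℕ; _≤_)
open import Data.Fin.Subset using (Subset; ∣_∣; _∩_; Nonempty)
open import Data.List using (List; length)
open import Data.List.Membership.Propositional using (_∈_)
open import Data.List.Relation.Unary.All using (All)
open import Data.List.Relation.Unary.Unique.Propositional using (Unique)
open import Relation.Binary.PropositionalEquality using (_≡_)
open import Data.Product using (Σ; _×_)

record Hypergraph (n : ℕ) : Set where
  field
    edges  : List (Subset n)
    simple : Unique edges
open Hypergraph public

numEdges : ∀ {n} → Hypergraph n → ℕ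
numEdges H = length (edges H)

Uniform : ∀ {n} → ℕ → Hypergraph n → Set
Uniform r H = All (λ e → ∣ e ∣ ≡ r) (edges H)

Intersecting : ∀ {n} → Hypergraph n → Set
Intersecting H = ∀ {e f} → e ∈ edges H → f ∈ edges H → Nonempty (e ∩ f)

IsCover : ∀ {n} → Hypergraph n → Subset n → Set
IsCover H C = All (λ e → Nonempty (C ∩ e)) (edges H)

CoveringNumber≤ : ∀ {n} → Hypergraph n → ℕ → Set
CoveringNumber≤ H k = Σ (Subset _) (λ C → IsCover H C × ∣ C ∣ ≤ k)

-- In an intersecting r-uniform family with m edges, the degrees along any edge sum to
-- at least m + r - 1: the edge meets itself in r vertices and every other edge in at
-- least one.  If every vertex missed more than B edges, every degree would be at most
-- m - B - 1 and that sum at most r (m - B - 1), impossible when (r - 1) m < r (B + 2) - 1.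
-- So some vertex misses at most B edges; covering those recursively covers at most
-- 2, 4, 7 edges by 1, 2, 3 vertices.  With 11 edges, either some vertex misses at most
-- 7 edges, or every degree is at most 3; then the degree sum along each edge is forced
-- to be exactly 15, every covered vertex has degree 3, and 3 divides 5 · 11 = 55.
module Submission where

open import Defs
open import Data.Bool.Base using (if_then_else_)
open import Data.Empty using (⊥-elim)
open import Data.Fin.Base using (Fin; zero; suc)
open import Data.Fin.Properties using (any?)
open import Data.Fin.Subset using (Subset; ∣_∣; _∩_; _∪_; _∈_; ⁅_⁆; ⊥; ⊤; Nonempty; inside; outside)
open import Data.Fin.Subset.Properties
  using (_∈?_; ∣p∣≤∣x∷p∣; ∣⊥∣≡0; ∣⁅x⁆∣≡1; ∩-idem; ∩-identityˡ; x∈p∩q⁺; x∈p∩q⁻; x∈p∪q⁺; x∈⁅x⁆)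
open import Data.List.Base using (List; []; _∷_; length; map; filter)
import Data.List.Membership.Propositional as List
open import Data.List.Membership.Propositional.Properties using (∈-filter⁺; ∈-filter⁻)
open import Data.List.Properties using (filter-none)
open import Data.List.Relation.Unary.All as All using (All; []; _∷_)
open import Data.List.Relation.Unary.All.Properties using (¬Any⇒All¬)
import Data.List.Relation.Unary.All.Properties as All
open import Data.List.Relation.Unary.Any as Any using ()
import Data.List.Relation.Unary.Unique.Propositional.Properties as Unique
open import Data.Nat.Base using (ℕ; zero; suc; _+_; _*_; _≤_; _<_; z≤n; s≤s)
open import Data.Nat.Divisibility using (_∣_; _∣?_; _∣0; ∣-refl; ∣m∣n⇒∣m+n)
open import Data.Nat.ListAction using (sum)
open import Data.Nat.Properties
open import Algebra.Properties.CommutativeSemigroup +-commutativeSemigroup using (interchange; x∙yz≈yx∙z)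
open import Data.Product.Base using (∃; _×_; _,_; proj₁)
open import Data.Sum.Base using (_⊎_; inj₁; inj₂)
open import Data.Vec.Base using ([]; _∷_; here; there)
open import Function.Base using (_∘_)
open import Relation.Nullary.Decidable using (yes; no; does; from-yes; from-no)
open import Relation.Nullary.Negation using (¬_)
open import Relation.Unary using (Pred; Decidable)
open import Relation.Unary.Properties using (∁?)
open import Relation.Binary.PropositionalEquality
  using (_≡_; refl; sym; trans; cong; cong₂; subst; subst₂; module ≡-Reasoning)

private
  variable
    n : ℕ

sumOver : Subset n → (Fin n → ℕ) → ℕ
sumOver []            f = 0
sumOver (inside ∷ p)  f = f zero + sumOver p (f ∘ suc)
sumOver (outside ∷ p) f = sumOver p (f ∘ suc)

indicator : Subset n → Fin n → ℕ
indicator q x = if does (x ∈? q) then 1 else 0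

sumOver-cong : ∀ (p : Subset n) {f g} → (∀ x → f x ≡ g x) → sumOver p f ≡ sumOver p g
sumOver-cong []            f≗g = refl
sumOver-cong (inside ∷ p)  f≗g = cong₂ _+_ (f≗g zero) (sumOver-cong p (f≗g ∘ suc))
sumOver-cong (outside ∷ p) f≗g = sumOver-cong p (f≗g ∘ suc)

sumOver-+ : ∀ (p : Subset n) f g → sumOver p (λ x → f x + g x) ≡ sumOver p f + sumOver p g
sumOver-+ []            f g = refl
sumOver-+ (outside ∷ p) f g = sumOver-+ p (f ∘ suc) (g ∘ suc)
sumOver-+ (inside ∷ p)  f g = begin
  f zero + g zero + sumOver p (λ x → f (suc x) + g (suc x))
    ≡⟨ cong (f zero + g zero +_) (sumOver-+ p (f ∘ suc) (g ∘ suc)) ⟩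
  f zero + g zero + (sumOver p (f ∘ suc) + sumOver p (g ∘ suc))
    ≡⟨ interchange (f zero) (g zero) _ _ ⟩
  f zero + sumOver p (f ∘ suc) + (g zero + sumOver p (g ∘ suc))
    ∎
  where open ≡-Reasoning

sumOver-const : ∀ (p : Subset n) c → sumOver p (λ _ → c) ≡ ∣ p ∣ * c
sumOver-const []            c = refl
sumOver-const (inside ∷ p)  c = cong (c +_) (sumOver-const p c)
sumOver-const (outside ∷ p) c = sumOver-const p c

sumOver-mono-≤ : ∀ (p : Subset n) {f g} → (∀ x → f x ≤ g x) → sumOver p f ≤ sumOver p g
sumOver-mono-≤ []            f≤g = z≤n
sumOver-mono-≤ (inside ∷ p)  f≤g = +-mono-≤ (f≤g zero) (sumOver-mono-≤ p (f≤g ∘ suc))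
sumOver-mono-≤ (outside ∷ p) f≤g = sumOver-mono-≤ p (f≤g ∘ suc)

sumOver-mono-< : ∀ {p : Subset n} {f g x} → (∀ y → f y ≤ g y) → x ∈ p → f x < g x
               → sumOver p f < sumOver p g
sumOver-mono-< {p = inside ∷ p}  f≤g here        fx<gx =
  +-mono-<-≤ fx<gx (sumOver-mono-≤ p (f≤g ∘ suc))
sumOver-mono-< {p = inside ∷ p}  f≤g (there x∈p) fx<gx =
  +-mono-≤-< (f≤g zero) (sumOver-mono-< (f≤g ∘ suc) x∈p fx<gx)
sumOver-mono-< {p = outside ∷ p} f≤g (there x∈p) fx<gx =
  sumOver-mono-< (f≤g ∘ suc) x∈p fx<gx

sumOver-bounded : ∀ (p : Subset n) f {b c} → (∀ x → f x + b ≤ c) → sumOver p f + ∣ p ∣ * b ≤ ∣ p ∣ * c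
sumOver-bounded p f {b} {c} f+b≤c = begin
  sumOver p f + ∣ p ∣ * b            ≡⟨ cong (sumOver p f +_) (sym (sumOver-const p b)) ⟩
  sumOver p f + sumOver p (λ _ → b)  ≡⟨ sym (sumOver-+ p f (λ _ → b)) ⟩
  sumOver p (λ x → f x + b)          ≤⟨ sumOver-mono-≤ p f+b≤c ⟩
  sumOver p (λ _ → c)                ≡⟨ sumOver-const p c ⟩
  ∣ p ∣ * c                          ∎
  where open ≤-Reasoning

∣-sumOver : ∀ (p : Subset n) {f d} → (∀ x → d ∣ f x) → d ∣ sumOver p f
∣-sumOver []            {d = d} _ = d ∣0
∣-sumOver (inside ∷ p)  d∣f = ∣m∣n⇒∣m+n (d∣f zero) (∣-sumOver p (d∣f ∘ suc))
∣-sumOver (outside ∷ p) d∣f = ∣-sumOver p (d∣f ∘ suc)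

sumOver-indicator : ∀ (p q : Subset n) → sumOver p (indicator q) ≡ ∣ p ∩ q ∣
sumOver-indicator []            []            = refl
sumOver-indicator (inside ∷ p)  (inside ∷ q)  = cong suc (sumOver-indicator p q)
sumOver-indicator (inside ∷ p)  (outside ∷ q) = sumOver-indicator p q
sumOver-indicator (outside ∷ p) (_ ∷ q)       = sumOver-indicator p q

nonempty⇒∣p∣>0 : {p : Subset n} → Nonempty p → 0 < ∣ p ∣
nonempty⇒∣p∣>0 (_ , here)                     = s≤s z≤n
nonempty⇒∣p∣>0 {p = s ∷ p} (suc x , there x∈p) = ≤-trans (nonempty⇒∣p∣>0 (x , x∈p)) (∣p∣≤∣x∷p∣ s p)

∣p∪q∣≤∣p∣+∣q∣ : ∀ (p q : Subset n) → ∣ p ∪ q ∣ ≤ ∣ p ∣ + ∣ q ∣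
∣p∪q∣≤∣p∣+∣q∣ []            []            = z≤n
∣p∪q∣≤∣p∣+∣q∣ (inside ∷ p)  (inside ∷ q)  =
  s≤s (≤-trans (∣p∪q∣≤∣p∣+∣q∣ p q) (+-monoʳ-≤ ∣ p ∣ (n≤1+n ∣ q ∣)))
∣p∪q∣≤∣p∣+∣q∣ (inside ∷ p)  (outside ∷ q) = s≤s (∣p∪q∣≤∣p∣+∣q∣ p q)
∣p∪q∣≤∣p∣+∣q∣ (outside ∷ p) (inside ∷ q)  =
  ≤-trans (s≤s (∣p∪q∣≤∣p∣+∣q∣ p q)) (≤-reflexive (sym (+-suc ∣ p ∣ ∣ q ∣)))
∣p∪q∣≤∣p∣+∣q∣ (outside ∷ p) (outside ∷ q) = ∣p∪q∣≤∣p∣+∣q∣ p q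

module _ {a} {A : Set a} where

  length-filter-∁ : ∀ {p} {P : Pred A p} (P? : Decidable P) xs
                  → length (filter (∁? P?) xs) + length (filter P? xs) ≡ length xs
  length-filter-∁ P? []       = refl
  length-filter-∁ P? (x ∷ xs) with P? x
  ... | yes _ = trans (+-suc _ _) (cong suc (length-filter-∁ P? xs))
  ... | no  _ = cong suc (length-filter-∁ P? xs)

  length≤sum-map : ∀ (g : A → ℕ) {xs} → All (λ x → 1 ≤ g x) xs → length xs ≤ sum (map g xs)
  length≤sum-map g []           = z≤n
  length≤sum-map g (1≤gx ∷ 1≤g) = +-mono-≤ 1≤gx (length≤sum-map g 1≤g)

  ∈⇒+length≤sum-map : ∀ (g : A → ℕ) {xs y} → All (λ x → 1 ≤ g x) xs → y List.∈ xs
                    → g y + length xs ≤ suc (sum (map g xs))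
  ∈⇒+length≤sum-map g {y ∷ xs} (_ ∷ 1≤g) (Any.here refl) =
    ≤-trans (≤-reflexive (+-suc (g y) (length xs))) (s≤s (+-monoʳ-≤ (g y) (length≤sum-map g 1≤g)))
  ∈⇒+length≤sum-map g {x ∷ xs} {y} (1≤gx ∷ 1≤g) (Any.there y∈xs) = begin
    g y + suc (length xs)      ≡⟨ +-suc (g y) (length xs) ⟩
    suc (g y + length xs)      ≤⟨ s≤s (∈⇒+length≤sum-map g 1≤g y∈xs) ⟩
    suc (suc (sum (map g xs))) ≤⟨ s≤s (+-monoˡ-≤ (sum (map g xs)) 1≤gx) ⟩
    suc (g x + sum (map g xs)) ∎
    where open ≤-Reasoning

  sum-map-≡ : ∀ (g : A → ℕ) {c xs} → All (λ x → g x ≡ c) xs → sum (map g xs) ≡ length xs * c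
  sum-map-≡ g []            = refl
  sum-map-≡ g (gx≡c ∷ g≡c) = cong₂ _+_ gx≡c (sum-map-≡ g g≡c)

degree : List (Subset n) → Fin n → ℕ
degree G x = length (filter (x ∈?_) G)

MaxDegree≤ : List (Subset n) → ℕ → Set
MaxDegree≤ G D = ∀ x → degree G x ≤ D

degree-∷ : ∀ (f : Subset n) G x → degree (f ∷ G) x ≡ indicator f x + degree G x
degree-∷ f G x with x ∈? f
... | yes _ = refl
... | no  _ = refl

degree≡0⊎incident : ∀ (G : List (Subset n)) v → degree G v ≡ 0 ⊎ ∃ λ e → e List.∈ G × v ∈ e
degree≡0⊎incident G v with Any.any? (v ∈?_) G
... | yes incident = inj₂ (List.find incident)
... | no  isolated = inj₁ (cong length (filter-none (v ∈?_) (¬Any⇒All¬ G isolated)))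

sumOver-degree : ∀ (p : Subset n) G → sumOver p (degree G) ≡ sum (map (λ f → ∣ p ∩ f ∣) G)
sumOver-degree p []      = trans (sumOver-const p 0) (*-zeroʳ ∣ p ∣)
sumOver-degree p (f ∷ G) = begin
  sumOver p (degree (f ∷ G))                      ≡⟨ sumOver-cong p (degree-∷ f G) ⟩
  sumOver p (λ x → indicator f x + degree G x)    ≡⟨ sumOver-+ p (indicator f) (degree G) ⟩
  sumOver p (indicator f) + sumOver p (degree G)  ≡⟨ cong₂ _+_ (sumOver-indicator p f) (sumOver-degree p G) ⟩
  ∣ p ∩ f ∣ + sum (map (λ f → ∣ p ∩ f ∣) G)       ∎
  where open ≡-Reasoning

module _ (H : Hypergraph n) where

  private
    G = edges H
    m = numEdges H

  sumOver⊤-degree : ∀ {r} → Uniform r H → sumOver ⊤ (degree G) ≡ m * r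
  sumOver⊤-degree U = trans (sumOver-degree ⊤ G)
    (sum-map-≡ (λ f → ∣ ⊤ ∩ f ∣) (All.map (λ {f} ∣f∣≡r → trans (cong ∣_∣ (∩-identityˡ f)) ∣f∣≡r) U))

  edge-degreeSum : Intersecting H → ∀ {e} → e List.∈ G → ∣ e ∣ + m ≤ suc (sumOver e (degree G))
  edge-degreeSum I {e} e∈G = subst₂ _≤_
    (cong (_+ m) (cong ∣_∣ (∩-idem e)))
    (cong suc (sym (sumOver-degree e G)))
    (∈⇒+length≤sum-map (λ f → ∣ e ∩ f ∣) (All.tabulate (λ f∈G → nonempty⇒∣p∣>0 (I e∈G f∈G))) e∈G)

avoiding : Fin n → Hypergraph n → Hypergraph n
avoiding x H = record
  { edges  = filter (∁? (x ∈?_)) (edges H)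
  ; simple = Unique.filter⁺ (∁? (x ∈?_)) (simple H)
  }

module _ (x : Fin n) (H : Hypergraph n) where

  numEdges-avoiding : numEdges (avoiding x H) + degree (edges H) x ≡ numEdges H
  numEdges-avoiding = length-filter-∁ (x ∈?_) (edges H)

  avoiding≰⇒degree+≤ : ∀ {B} → ¬ numEdges (avoiding x H) ≤ B → degree (edges H) x + suc B ≤ numEdges H
  avoiding≰⇒degree+≤ {B} many = subst (degree (edges H) x + suc B ≤_) numEdges-avoiding
    (≤-trans (≤-reflexive (+-comm _ (suc B))) (+-monoˡ-≤ (degree (edges H) x) (≰⇒> many)))

  uniform-avoiding : ∀ {r} → Uniform r H → Uniform r (avoiding x H)
  uniform-avoiding = All.filter⁺ (∁? (x ∈?_))

  intersecting-avoiding : Intersecting H → Intersecting (avoiding x H)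
  intersecting-avoiding I e∈ f∈ =
    I (proj₁ (∈-filter⁻ (∁? (x ∈?_)) e∈)) (proj₁ (∈-filter⁻ (∁? (x ∈?_)) f∈))

  cover-avoiding : ∀ {C} → IsCover (avoiding x H) C → IsCover H (C ∪ ⁅ x ⁆)
  cover-avoiding {C} cover = All.tabulate covered
    where
    covered : ∀ {e} → e List.∈ edges H → Nonempty ((C ∪ ⁅ x ⁆) ∩ e)
    covered {e} e∈H with x ∈? e
    ... | yes x∈e = x , x∈p∩q⁺ (x∈p∪q⁺ (inj₂ (x∈⁅x⁆ x)) , x∈e)
    ... | no  x∉e with All.lookup cover (∈-filter⁺ (∁? (x ∈?_)) e∈H x∉e)
    ...   | y , y∈C∩e with x∈p∩q⁻ C e y∈C∩e
    ...     | y∈C , y∈e = y , x∈p∩q⁺ (x∈p∪q⁺ (inj₁ y∈C) , y∈e)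

  coveringNumber-avoiding : ∀ {k} → CoveringNumber≤ (avoiding x H) k → CoveringNumber≤ H (suc k)
  coveringNumber-avoiding {k} (C , cover , ∣C∣≤k) = C ∪ ⁅ x ⁆ , cover-avoiding cover , (begin
    ∣ C ∪ ⁅ x ⁆ ∣        ≤⟨ ∣p∪q∣≤∣p∣+∣q∣ C ⁅ x ⁆ ⟩
    ∣ C ∣ + ∣ ⁅ x ⁆ ∣    ≡⟨ cong (∣ C ∣ +_) (∣⁅x⁆∣≡1 x) ⟩
    ∣ C ∣ + 1            ≤⟨ +-monoˡ-≤ 1 ∣C∣≤k ⟩
    k + 1                ≡⟨ +-comm k 1 ⟩
    suc k                ∎)
    where open ≤-Reasoning

coveringNumber-noEdges : ∀ (H : Hypergraph n) {k} → edges H ≡ [] → CoveringNumber≤ H k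
coveringNumber-noEdges {n} H noEdges =
  ⊥ , subst (All _) (sym noEdges) [] , ≤-trans (≤-reflexive (∣⊥∣≡0 n)) z≤n

SmallCover : ℕ → ℕ → ℕ → Set
SmallCover r M k =
  ∀ {n} (H : Hypergraph n) → Uniform r H → Intersecting H → numEdges H ≤ M → CoveringNumber≤ H k

smallCover-zero : ∀ {r} → SmallCover r 0 0
smallCover-zero H@record { edges = [] } _ _ _ = coveringNumber-noEdges H refl
smallCover-zero record { edges = _ ∷ _ } _ _ ()

-- With r = suc s, the bound reads (r - 1) M < r (B + 2) - 1.
smallCover-suc : ∀ {s B M k} → s * M < s + suc s * suc B
               → SmallCover (suc s) B k → SmallCover (suc s) M (suc k)
smallCover-suc bound cover H@record { edges = [] } _ _ _ = coveringNumber-noEdges H refl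
smallCover-suc {s} {B} {M} bound cover H@record { edges = e ∷ _ } U I m≤M
  with any? (λ x → numEdges (avoiding x H) ≤? B)
... | yes (x , few) =
  coveringNumber-avoiding x H (cover (avoiding x H) (uniform-avoiding x H U) (intersecting-avoiding x H I) few)
... | no many = ⊥-elim (<-irrefl refl (begin-strict
    s * M                  <⟨ bound ⟩
    s + suc s * suc B      ≤⟨ +-cancelˡ-≤ m _ _ degreeSums ⟩
    s * m                  ≤⟨ *-monoʳ-≤ s m≤M ⟩
    s * M                  ∎))
  where
  open ≤-Reasoning
  m : ℕ
  m = numEdges H
  Σ : ℕ
  Σ = sumOver e (degree (edges H))
  e∈H : e List.∈ edges H
  e∈H = Any.here refl
  ∣e∣≡r : ∣ e ∣ ≡ suc s
  ∣e∣≡r = All.lookup U e∈H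
  lower : suc s + m ≤ suc Σ
  lower = subst (λ r → r + m ≤ suc Σ) ∣e∣≡r (edge-degreeSum H I e∈H)
  upper : Σ + suc s * suc B ≤ suc s * m
  upper = subst (λ r → Σ + r * suc B ≤ r * m) ∣e∣≡r
    (sumOver-bounded e (degree (edges H)) (λ x → avoiding≰⇒degree+≤ x H (λ few → many (x , few))))
  degreeSums : m + (s + suc s * suc B) ≤ m + s * m
  degreeSums = ≤-pred (begin
    suc (m + (s + suc s * suc B)) ≡⟨ cong suc (x∙yz≈yx∙z m s (suc s * suc B)) ⟩
    suc s + m + suc s * suc B     ≤⟨ +-monoˡ-≤ (suc s * suc B) lower ⟩
    suc (Σ + suc s * suc B)       ≤⟨ s≤s upper ⟩
    suc (suc s * m)               ∎)

τ≤1 : SmallCover 5 2 1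
τ≤1 = smallCover-suc (from-yes (8 <? 9)) smallCover-zero

τ≤2 : SmallCover 5 4 2
τ≤2 = smallCover-suc (from-yes (16 <? 19)) τ≤1

τ≤3 : SmallCover 5 7 3
τ≤3 = smallCover-suc (from-yes (28 <? 29)) τ≤2

module _ {r D} (H : Hypergraph n) (U : Uniform r H) (I : Intersecting H) (≤D : MaxDegree≤ (edges H) D)
         (tight : suc (r * D) ≤ r + numEdges H) where

  -- tight says m + r - 1 ≥ r·D, so the degree sum along an edge, at least m + r - 1 and
  -- at most r·D, leaves no room for a vertex of degree below D.
  tight⇒degree≡ : ∀ {e v} → e List.∈ edges H → v ∈ e → degree (edges H) v ≡ D
  tight⇒degree≡ {e} {v} e∈H v∈e with m≤n⇒m<n∨m≡n (≤D v)
  ... | inj₂ ≡D = ≡D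
  ... | inj₁ <D = ⊥-elim (<-irrefl refl (begin-strict
    suc (r * D)                         ≤⟨ tight ⟩
    r + numEdges H                      ≡⟨ cong (_+ numEdges H) (sym ∣e∣≡r) ⟩
    ∣ e ∣ + numEdges H                  ≤⟨ edge-degreeSum H I e∈H ⟩
    suc (sumOver e (degree (edges H)))  ≤⟨ sumOver-mono-< ≤D v∈e <D ⟩
    sumOver e (λ _ → D)                 ≡⟨ sumOver-const e D ⟩
    ∣ e ∣ * D                           ≡⟨ cong (_* D) ∣e∣≡r ⟩
    r * D                               <⟨ n<1+n (r * D) ⟩
    suc (r * D)                         ∎))
    where
    open ≤-Reasoning
    ∣e∣≡r : ∣ e ∣ ≡ r
    ∣e∣≡r = All.lookup U e∈H

  tight⇒∣numEdges* : D ∣ numEdges H * r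
  tight⇒∣numEdges* = subst (D ∣_) (sumOver⊤-degree H U) (∣-sumOver ⊤ D∣degree)
    where
    D∣degree : ∀ v → D ∣ degree (edges H) v
    D∣degree v with degree≡0⊎incident (edges H) v
    ... | inj₁ ≡0              = subst (D ∣_) (sym ≡0) (D ∣0)
    ... | inj₂ (e , e∈H , v∈e) = subst (D ∣_) (sym (tight⇒degree≡ e∈H v∈e)) ∣-refl

mainTheorem4 : (n : ℕ) (H : Hypergraph n) → Uniform 5 H → Intersecting H
    → numEdges H ≡ 11 → CoveringNumber≤ H 4
mainTheorem4 n H U I eleven with any? (λ x → numEdges (avoiding x H) ≤? 7)
... | yes (x , few) =
  coveringNumber-avoiding x H (τ≤3 (avoiding x H) (uniform-avoiding x H U) (intersecting-avoiding x H I) few)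
... | no many =
  ⊥-elim (from-no (3 ∣? 55) (subst (3 ∣_) (cong (_* 5) eleven) (tight⇒∣numEdges* H U I ≤3 tight)))
  where
  ≤3 : MaxDegree≤ (edges H) 3
  ≤3 x = +-cancelʳ-≤ 8 _ 3
    (subst (degree (edges H) x + 8 ≤_) eleven (avoiding≰⇒degree+≤ x H (λ few → many (x , few))))
  tight : 16 ≤ 5 + numEdges H
  tight = ≤-reflexive (cong (5 +_) (sym eleven))
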